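{- For every $n$ and every deterministic comparison-based algorithm $\mathcal{A}$ that finds the median of $n$ elements, there is an input on which the median element participates in at least $\lceil \log_2 n\rceil - 1$ comparisons.
   Context: Inputs are elements of a totally ordered set accessed only through pairwise comparisons. The fragile complexity of a particular element is the number of comparisons it participates in. -}

module Defs where

open import Data.Nat using (ℕ; zero; suc; _+_; _∸_; _<_; _<?_)
open import Data.Nat.DivMod using (_/_)
open import Data.Fin using (Fin)
open import Data.Fin.Properties using () renaming (_≟_ to _≟ᶠ_)
open import Data.List using (List; length; filter; allFin)
open import Relation.Nullary using (yes; no)
open import Relation.Binary.PropositionalEquality using (_≡_)
open import Function.Definitions using (Injective)

-- A deterministic comparison-based algorithm on n input positions,
-- presented as a (finite) decision tree.  An internal node
-- 'cmp i j l r' compares the elements at positions i and j and continues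
-- with l if x i < x j and with r otherwise.
data Algorithm (n : ℕ) : Set where
  leaf : Fin n → Algorithm n
  cmp  : Fin n → Fin n → Algorithm n → Algorithm n → Algorithm n

-- An input: the elements at positions 0..n-1, drawn from a totally ordered
-- set (ℕ suffices, since the algorithm only sees the relative order).
-- Inputs consist of distinct elements.
Input : ℕ → Set
Input n = Fin n → ℕ

DistinctInput : {n : ℕ} → Input n → Set
DistinctInput x = Injective _≡_ _≡_ x

run : {n : ℕ} → Algorithm n → Input n → Fin n
run (leaf o)      x = o
run (cmp i j l r) x with x i <? x j
... | yes _ = run l x
... | no  _ = run r x

involved : {n : ℕ} → Fin n → Fin n → Fin n → ℕ
involved e i j with e ≟ᶠ i | e ≟ᶠ j
... | no _  | no _ = 0
... | _     | _    = 1

fragility : {n : ℕ} → Algorithm n → Input n → Fin n → ℕ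
fragility (leaf o)      x e = 0
fragility (cmp i j l r) x e with x i <? x j
... | yes _ = involved e i j + fragility l x e
... | no  _ = involved e i j + fragility r x e

rank : {n : ℕ} → Input n → Fin n → ℕ
rank {n} x m = length (filter (λ i → x i <? x m) (allFin n))

IsMedian : {n : ℕ} → Input n → Fin n → Set
IsMedian {n} x m = rank x m ≡ (n ∸ 1) / 2

FindsMedian : {n : ℕ} → Algorithm n → Set
FindsMedian {n} A = (x : Input n) → DistinctInput x → IsMedian x (run A x)

-- Adversary argument.  With k = ⌊(n-1)/2⌋, the adversary fixes positions 0, …, k-1 as the k
-- smallest elements and gives every other position weight 1; positions of positive weight are the
-- candidates for the median.  Comparisons whose outcome is already determined are answered
-- accordingly; when two candidates meet, the heavier one wins, the loser is fixed above all
-- candidates and its weight moves to the winner, whose weight therefore at most doubles.  A correct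
-- algorithm can only output a candidate carrying the whole weight n - k: were another candidate c
-- left, the input making c the median would defeat it.  So the median took part in at least
-- log₂ (n - k) ≥ ⌈log₂ n⌉ - 1 comparisons.
module Submission where

open import Defs
open import Data.Nat using (ℕ; zero; suc; _+_; _⊔_; _*_; _^_; _∸_; _≤_; _<_; _≥_; z≤n; s≤s; _<?_; _≤?_)
open import Data.Nat.Properties
open import Data.Nat.Logarithm using (⌈log₂_⌉; ⌈log₂⌉-mono-≤; ⌈log₂2^n⌉≡n)
open import Data.Nat.DivMod using (_/_; m/n≤m; m/n*n≤m)
open import Data.Nat.Tactic.RingSolver using (solve-∀)
open import Data.Fin using (Fin; toℕ; punchIn) renaming (zero to fzero; suc to fsuc)
open import Data.Fin.Properties using (punchInᵢ≢i; toℕ<n; toℕ-injective) renaming (_≟_ to _≟ᶠ_)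
open import Data.Vec.Functional using (Vector; updateAt; removeAt)
open import Data.Vec.Functional.Properties using (updateAt-updates; updateAt-minimal)
open import Data.List using (length; filter; tabulate)
open import Data.Sum as Sum using (_⊎_; inj₁; inj₂)
open import Data.Product as Prod using (Σ; ∃-syntax; _×_; _,_; _,′_; proj₁; proj₂)
open import Function using (_∘_; id; const; case_of_)
open import Relation.Nullary using (Dec; does; yes; no; ¬_; contradiction)
open import Data.Bool using (if_then_else_)
open import Relation.Unary using (Pred; Decidable)
open import Relation.Binary.PropositionalEquality
open import Algebra.Properties.CommutativeMonoid.Sum +-0-commutativeMonoid
  using (sum; sum-syntax; sum-remove; sum-cong-≗; ∑-distrib-+)

-- Defined through 'does' so that 𝟙 (suc m <? suc n) and 𝟙 (m <? n) are definitionally equal.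
𝟙 : ∀ {a} {A : Set a} → Dec A → ℕ
𝟙 d = if does d then 1 else 0

𝟙≤1 : ∀ {a} {A : Set a} (d : Dec A) → 𝟙 d ≤ 1
𝟙≤1 (yes _) = ≤-refl
𝟙≤1 (no _)  = z≤n

𝟙-mono : ∀ {a b} {A : Set a} {B : Set b} → (A → B) → (d : Dec A) (d′ : Dec B) → 𝟙 d ≤ 𝟙 d′
𝟙-mono f (yes a) (yes _) = ≤-refl
𝟙-mono f (yes a) (no ¬b) = contradiction (f a) ¬b
𝟙-mono f (no _)  _       = z≤n

𝟙-yes : ∀ {a} {A : Set a} → A → (d : Dec A) → 𝟙 d ≡ 1
𝟙-yes a (yes _) = refl
𝟙-yes a (no ¬a) = contradiction a ¬a

𝟙-no : ∀ {a} {A : Set a} → ¬ A → (d : Dec A) → 𝟙 d ≡ 0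
𝟙-no ¬a (yes a) = contradiction a ¬a
𝟙-no ¬a (no _)  = refl

𝟙-< : ∀ {a b} {A : Set a} {B : Set b} → ¬ A → B → (d : Dec A) (d′ : Dec B) → 𝟙 d < 𝟙 d′
𝟙-< ¬a b (yes a) _       = contradiction a ¬a
𝟙-< ¬a b (no _)  (yes _) = ≤-refl
𝟙-< ¬a b (no _)  (no ¬b) = contradiction b ¬b

sum-mono-≤ : ∀ {m} {f g : Vector ℕ m} → (∀ i → f i ≤ g i) → sum f ≤ sum g
sum-mono-≤ {zero}  f≤g = z≤n
sum-mono-≤ {suc m} f≤g = +-mono-≤ (f≤g fzero) (sum-mono-≤ (f≤g ∘ fsuc))

sum-mono-< : ∀ {m} {f g : Vector ℕ m} → (∀ i → f i ≤ g i) → ∀ j → f j < g j → sum f < sum g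
sum-mono-< {suc m} f≤g fzero    f<g = +-mono-<-≤ f<g (sum-mono-≤ (f≤g ∘ fsuc))
sum-mono-< {suc m} f≤g (fsuc j) f<g = +-mono-≤-< (f≤g fzero) (sum-mono-< (f≤g ∘ fsuc) j f<g)

sum-positive : ∀ {m} (f : Vector ℕ m) → 0 < sum f → ∃[ i ] 0 < f i
sum-positive {suc m} f 0<Σ with f fzero in eq
... | suc _ = fzero , subst (0 <_) (sym eq) (s≤s z≤n)
... | zero with sum-positive (f ∘ fsuc) 0<Σ
...   | i , 0<fi = fsuc i , 0<fi

sum-positive-elsewhere : ∀ {m} (f : Vector ℕ m) i → f i ≢ sum f → ∃[ j ] j ≢ i × 0 < f j
sum-positive-elsewhere {suc m} f i fi≢Σ =
  let j , 0<fj = sum-positive (removeAt f i) (n≢0⇒n>0 rest≢0) in punchIn i j , punchInᵢ≢i i j , 0<fj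
  where
  rest≢0 : sum (removeAt f i) ≢ 0
  rest≢0 rest≡0 = fi≢Σ (sym (trans (sum-remove f) (trans (cong (f i +_) rest≡0) (+-identityʳ (f i)))))

sum-updateAt : ∀ {m} (i : Fin m) (f : ℕ → ℕ) (xs : Vector ℕ m) →
               sum (updateAt xs i f) + xs i ≡ f (xs i) + sum xs
sum-updateAt fzero    f xs = swap (f (xs fzero)) (xs fzero) (sum (xs ∘ fsuc))
  where
  swap : ∀ a b c → a + c + b ≡ a + (b + c)
  swap = solve-∀
sum-updateAt (fsuc i) f xs = begin
  xs fzero + sum (updateAt (xs ∘ fsuc) i f) + xs (fsuc i)   ≡⟨ +-assoc (xs fzero) _ _ ⟩
  xs fzero + (sum (updateAt (xs ∘ fsuc) i f) + xs (fsuc i)) ≡⟨ cong (xs fzero +_) (sum-updateAt i f (xs ∘ fsuc)) ⟩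
  xs fzero + (f (xs (fsuc i)) + sum (xs ∘ fsuc))            ≡⟨ +-left-comm (xs fzero) (f (xs (fsuc i))) _ ⟩
  f (xs (fsuc i)) + (xs fzero + sum (xs ∘ fsuc))            ∎
  where
  open ≡-Reasoning
  +-left-comm : ∀ a b c → a + (b + c) ≡ b + (a + c)
  +-left-comm = solve-∀

length-filter-tabulate : ∀ {m} {a p} {A : Set a} {P : Pred A p} (P? : Decidable P) (f : Fin m → A) →
                         length (filter P? (tabulate f)) ≡ sum (λ i → 𝟙 (P? (f i)))
length-filter-tabulate {zero}  P? f = refl
length-filter-tabulate {suc m} P? f with P? (f fzero)
... | yes _ = cong suc (length-filter-tabulate P? (f ∘ fsuc))
... | no _  = length-filter-tabulate P? (f ∘ fsuc)

count-toℕ< : ∀ {m} t → t ≤ m → ∑[ i < m ] 𝟙 (toℕ i <? t) ≡ t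
count-toℕ< {zero}  zero    _         = refl
count-toℕ< {suc m} zero    _         = count-toℕ< {m} zero z≤n
count-toℕ< {suc m} (suc t) (s≤s t≤m) = cong suc (count-toℕ< t t≤m)

merge : ∀ {m} → Vector ℕ m → Fin m → Fin m → Vector ℕ m
merge w a b = updateAt (updateAt w b (const 0)) a (_+ w b)

module _ {m} (w : Vector ℕ m) {a b : Fin m} (a≢b : a ≢ b) where

  merge-winner : merge w a b a ≡ w a + w b
  merge-winner = trans (updateAt-updates a (updateAt w b (const 0)))
                       (cong (_+ w b) (updateAt-minimal a b w a≢b))

  merge-loser : merge w a b b ≡ 0
  merge-loser = trans (updateAt-minimal b a _ (a≢b ∘ sym)) (updateAt-updates b w)

  sum-merge : sum (merge w a b) ≡ sum w
  sum-merge = +-cancelʳ-≡ (w a) _ _ (begin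
    sum (merge w a b) + w a            ≡⟨ cong (sum (merge w a b) +_) (sym w₀a≡wa) ⟩
    sum (merge w a b) + w₀ a           ≡⟨ sum-updateAt a (_+ w b) w₀ ⟩
    w₀ a + w b + sum w₀                ≡⟨ +-assoc (w₀ a) (w b) (sum w₀) ⟩
    w₀ a + (w b + sum w₀)              ≡⟨ cong₂ _+_ w₀a≡wa (+-comm (w b) (sum w₀)) ⟩
    w a + (sum w₀ + w b)               ≡⟨ cong (w a +_) (sum-updateAt b (const 0) w) ⟩
    w a + sum w                        ≡⟨ +-comm (w a) (sum w) ⟩
    sum w + w a                        ∎)
    where
    open ≡-Reasoning
    w₀ : Vector ℕ m
    w₀ = updateAt w b (const 0)
    w₀a≡wa : w₀ a ≡ w a
    w₀a≡wa = updateAt-minimal a b w a≢b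

merge-other : ∀ {m} (w : Vector ℕ m) {a b e : Fin m} → e ≢ a → e ≢ b → merge w a b e ≡ w e
merge-other w e≢a e≢b = trans (updateAt-minimal _ _ _ e≢a) (updateAt-minimal _ _ w e≢b)

height : ∀ {n} → Algorithm n → ℕ
height (leaf _)      = 0
height (cmp _ _ l r) = suc (height l ⊔ height r)

next : ∀ {n} → Fin n → Fin n → Algorithm n → Algorithm n → Input n → Algorithm n
next i j l r x with x i <? x j
... | yes _ = l
... | no  _ = r

module _ {n} (i j : Fin n) (l r : Algorithm n) (x : Input n) where

  run-cmp : run (cmp i j l r) x ≡ run (next i j l r x) x
  run-cmp with x i <? x j
  ... | yes _ = refl
  ... | no  _ = refl

  fragility-cmp : ∀ e → fragility (cmp i j l r) x e ≡ involved e i j + fragility (next i j l r x) x e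
  fragility-cmp e with x i <? x j
  ... | yes _ = refl
  ... | no  _ = refl

  next-< : x i < x j → next i j l r x ≡ l
  next-< i<j with x i <? x j
  ... | yes _   = refl
  ... | no  i≮j = contradiction i<j i≮j

  next-≮ : ¬ x i < x j → next i j l r x ≡ r
  next-≮ i≮j with x i <? x j
  ... | yes i<j = contradiction i<j i≮j
  ... | no  _   = refl

involved-left : ∀ {n} (i j : Fin n) → involved i i j ≡ 1
involved-left i j with i ≟ᶠ i | i ≟ᶠ j
... | yes _ | _ = refl
... | no i≢i | _ = contradiction refl i≢i

involved-right : ∀ {n} (i j : Fin n) → involved j i j ≡ 1
involved-right i j with j ≟ᶠ i | j ≟ᶠ j
... | yes _ | _     = refl
... | no _  | yes _ = refl
... | no _  | no j≢j = contradiction refl j≢j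

⌈log₂⌉∸1≤ : ∀ {m} f → m ≤ 2 ^ suc f → ⌈log₂ m ⌉ ∸ 1 ≤ f
⌈log₂⌉∸1≤ {m} f m≤2^[1+f] =
  ∸-monoˡ-≤ 1 (subst (⌈log₂ m ⌉ ≤_) (⌈log₂2^n⌉≡n (suc f)) (⌈log₂⌉-mono-≤ m≤2^[1+f]))

module Adversary (n : ℕ) where

  k : ℕ
  k = (n ∸ 1) / 2

  W : ℕ
  W = n ∸ k

  k≤n : k ≤ n
  k≤n = ≤-trans (m/n≤m (n ∸ 1) 2) (m∸n≤m n 1)

  k<n : Fin n → k < n
  k<n o = ≤-<-trans (m/n≤m (n ∸ 1) 2) (∸-monoʳ-< (s≤s z≤n) (≤-<-trans z≤n (toℕ<n o)))

  k+k≤n : k + k ≤ n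
  k+k≤n = begin
    k + k        ≡⟨ cong (k +_) (+-identityʳ k) ⟨
    2 * k        ≡⟨ *-comm 2 k ⟩
    k * 2        ≤⟨ m/n*n≤m (n ∸ 1) 2 ⟩
    n ∸ 1        ≤⟨ m∸n≤m n 1 ⟩
    n            ∎
    where open ≤-Reasoning

  n≤2W : n ≤ 2 * W
  n≤2W = begin
    n            ≡⟨ m∸n+n≡m k≤n ⟨
    W + k        ≤⟨ +-monoʳ-≤ W k≤W ⟩
    W + W        ≡⟨ cong (W +_) (+-identityʳ W) ⟨
    2 * W        ∎
    where
    open ≤-Reasoning
    k≤W : k ≤ W
    k≤W = subst (_≤ W) (m+n∸n≡m k k) (∸-monoˡ-≤ k k+k≤n)

  -- The state of the adversary: w is the weight, val the value of every settled (weight 0)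
  -- position.  Positions below k are settled at their index; a settled position ≥ k has been
  -- eliminated and lies above every candidate.  A candidate eliminated at a node of height h gets
  -- value k + n + h, which keeps the settled values distinct because heights decrease along a run.
  record Valid (w val : Vector ℕ n) (h : ℕ) : Set where
    field
      low-settled    : ∀ e → toℕ e < k → w e ≡ 0 × val e ≡ toℕ e
      high-settled   : ∀ e → k ≤ toℕ e → w e ≡ 0 → k + n + h < val e
      settled-unique : ∀ e e′ → w e ≡ 0 → w e′ ≡ 0 → val e ≡ val e′ → e ≡ e′
      total-weight   : sum w ≡ W

  record Consistent (w val : Vector ℕ n) (x : Input n) : Set where
    field
      distinct        : DistinctInput x
      settled         : ∀ e → w e ≡ 0 → x e ≡ val e
      candidate-≥k    : ∀ r → 0 < w r → k ≤ x r
      candidate-<high : ∀ r e → 0 < w r → w e ≡ 0 → k ≤ toℕ e → x r < x e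

  open Valid
  open Consistent

  Correct : Algorithm n → (Input n → Set) → Set
  Correct T S = ∀ x → S x → IsMedian x (run T x)

  Witness : Algorithm n → Vector ℕ n → (Input n → Set) → Set
  Witness T w S = Σ (Input n) λ x → S x × W ≤ w (run T x) * 2 ^ fragility T x (run T x)

  weaken : ∀ {w val h h′} → h′ ≤ h → Valid w val h → Valid w val h′
  weaken h′≤h V = record
    { low-settled    = low-settled V
    ; high-settled   = λ e k≤e we≡0 → ≤-<-trans (+-monoʳ-≤ (k + n) h′≤h) (high-settled V e k≤e we≡0)
    ; settled-unique = settled-unique V
    ; total-weight   = total-weight V
    }

  candidate-high : ∀ {w val h} → Valid w val h → ∀ {r} → 0 < w r → k ≤ toℕ r
  candidate-high V {r} 0<wr with toℕ r <? k
  ... | yes r<k = contradiction (proj₁ (low-settled V r r<k)) (>⇒≢ 0<wr)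
  ... | no  r≮k = ≮⇒≥ r≮k

  Separated : Fin n → Fin n → (Input n → Set) → Set
  Separated i j S = ∀ {x} → S x → x i < x j

  Decided : Fin n → Fin n → (Input n → Set) → Set
  Decided i j S = Separated i j S ⊎ (∀ {x} → S x → ¬ x i < x j)

  separated⇒decided : ∀ {i j S} → Separated i j S ⊎ Separated j i S → Decided i j S
  separated⇒decided = Sum.map₂ (λ j<i s → <⇒≯ (j<i s))

  descend : ∀ {i j l r T′ w w′} {S S′ : Input n → Set} →
            (∀ {x} → S′ x → S x × next i j l r x ≡ T′) →
            (∀ o f → W ≤ w′ o * 2 ^ f → W ≤ w o * 2 ^ (involved o i j + f)) →
            Correct (cmp i j l r) S → (Correct T′ S′ → Witness T′ w′ S′) →
            Witness (cmp i j l r) w S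
  descend {i} {j} {l} {r} {T′} {w} {w′} {S} {S′} into charge correct recurse = lift (recurse correct′)
    where
    correct′ : Correct T′ S′
    correct′ x s′ with into s′
    ... | s , refl = subst (IsMedian x) (run-cmp i j l r x) (correct x s)
    lift : Witness T′ w′ S′ → Witness (cmp i j l r) w S
    lift (x , s′ , bound) with into s′
    ... | s , refl =
      x , s , subst (λ o → W ≤ w o * 2 ^ fragility (cmp i j l r) x o) (sym (run-cmp i j l r x))
                (subst (λ f → W ≤ w o′ * 2 ^ f) (sym (fragility-cmp i j l r x o′)) (charge o′ _ bound))
      where
      o′ : Fin n
      o′ = run (next i j l r x) x

  2^-weaken : ∀ c t f → W ≤ c * 2 ^ f → W ≤ c * 2 ^ (t + f)
  2^-weaken c t f W≤ = ≤-trans W≤ (*-monoʳ-≤ c (^-monoʳ-≤ 2 (m≤n+m f t)))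

  settled-decided : ∀ {w val i j} → w i ≡ 0 → w j ≡ 0 → Decided i j (Consistent w val)
  settled-decided {w} {val} {i} {j} wi≡0 wj≡0 with val i <? val j
  ... | yes vi<vj = inj₁ λ C → subst₂ _<_ (sym (settled C i wi≡0)) (sym (settled C j wj≡0)) vi<vj
  ... | no  vi≮vj = inj₂ λ C xi<xj → vi≮vj (subst₂ _<_ (settled C i wi≡0) (settled C j wj≡0) xi<xj)

  settled-vs-candidate : ∀ {w val h} → Valid w val h → ∀ {e r} → w e ≡ 0 → 0 < w r →
                         Separated e r (Consistent w val) ⊎ Separated r e (Consistent w val)
  settled-vs-candidate V {e} {r} we≡0 0<wr with toℕ e <? k
  ... | yes e<k = inj₁ λ C →
    <-≤-trans (subst (_< k) (sym (trans (settled C e we≡0) (proj₂ (low-settled V e e<k)))) e<k) (candidate-≥k C r 0<wr)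
  ... | no  e≮k = inj₂ λ C → candidate-<high C r e 0<wr we≡0 (≮⇒≥ e≮k)

  module Elimination {w val h h′} (V : Valid w val h) {a b} (a≢b : a ≢ b)
                     (0<wa : 0 < w a) (0<wb : 0 < w b) (h′<h : h′ < h) where

    w′ : Vector ℕ n
    w′ = merge w a b

    val′ : Vector ℕ n
    val′ = updateAt val b (const (k + n + h))

    0<w′a : 0 < w′ a
    0<w′a = subst (0 <_) (sym (merge-winner w a≢b)) (≤-trans 0<wa (m≤m+n (w a) (w b)))

    settled-stays : ∀ {e} → w e ≡ 0 → w′ e ≡ 0 × e ≢ b
    settled-stays {e} we≡0 = trans (merge-other w e≢a e≢b) we≡0 , e≢b
      where
      e≢a : e ≢ a
      e≢a refl = >⇒≢ 0<wa we≡0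
      e≢b : e ≢ b
      e≢b refl = >⇒≢ 0<wb we≡0

    settled-before : ∀ {e} → e ≢ b → w′ e ≡ 0 → w e ≡ 0
    settled-before {e} e≢b w′e≡0 with e ≟ᶠ a
    ... | yes refl = contradiction w′e≡0 (>⇒≢ 0<w′a)
    ... | no  e≢a  = trans (sym (merge-other w e≢a e≢b)) w′e≡0

    candidate-stays : ∀ {r} → 0 < w r → r ≢ b → 0 < w′ r
    candidate-stays {r} 0<wr r≢b with r ≟ᶠ a
    ... | yes refl = 0<w′a
    ... | no  r≢a  = subst (0 <_) (sym (merge-other w r≢a r≢b)) 0<wr

    val′-loser : val′ b ≡ k + n + h
    val′-loser = updateAt-updates b val

    val′-other : ∀ {e} → e ≢ b → val′ e ≡ val e
    val′-other {e} e≢b = updateAt-minimal e b val e≢b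

    k≤loser-value : k ≤ k + n + h
    k≤loser-value = ≤-trans (m≤m+n k n) (m≤m+n (k + n) h)

    loser-value-fresh : ∀ e → w e ≡ 0 → val e ≢ k + n + h
    loser-value-fresh e we≡0 ve≡ with toℕ e <? k
    ... | yes e<k = <⇒≱ (subst (_< k) (trans (sym (proj₂ (low-settled V e e<k))) ve≡) e<k) k≤loser-value
    ... | no  e≮k = <-irrefl (sym ve≡) (high-settled V e (≮⇒≥ e≮k) we≡0)

    valid : Valid w′ val′ h′
    valid = record
      { low-settled    = low
      ; high-settled   = high
      ; settled-unique = unique
      ; total-weight   = trans (sum-merge w a≢b) (total-weight V)
      }
      where
      low : ∀ e → toℕ e < k → w′ e ≡ 0 × val′ e ≡ toℕ e
      low e e<k with low-settled V e e<k
      ... | we≡0 , ve≡e = proj₁ (settled-stays we≡0) , trans (val′-other (proj₂ (settled-stays we≡0))) ve≡e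
      high : ∀ e → k ≤ toℕ e → w′ e ≡ 0 → k + n + h′ < val′ e
      high e k≤e w′e≡0 with e ≟ᶠ b
      ... | yes refl = subst (k + n + h′ <_) (sym val′-loser) (+-monoʳ-< (k + n) h′<h)
      ... | no  e≢b  = subst (k + n + h′ <_) (sym (val′-other e≢b))
                         (<-trans (+-monoʳ-< (k + n) h′<h) (high-settled V e k≤e (settled-before e≢b w′e≡0)))
      unique : ∀ e e′ → w′ e ≡ 0 → w′ e′ ≡ 0 → val′ e ≡ val′ e′ → e ≡ e′
      unique e e′ w′e≡0 w′e′≡0 v≡v′ with e ≟ᶠ b | e′ ≟ᶠ b
      ... | yes refl | yes refl = refl
      ... | yes refl | no e′≢b  = contradiction (trans (sym (val′-other e′≢b)) (trans (sym v≡v′) val′-loser))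
                                    (loser-value-fresh e′ (settled-before e′≢b w′e′≡0))
      ... | no e≢b   | yes refl = contradiction (trans (sym (val′-other e≢b)) (trans v≡v′ val′-loser))
                                    (loser-value-fresh e (settled-before e≢b w′e≡0))
      ... | no e≢b   | no e′≢b  = settled-unique V e e′
                                    (settled-before e≢b w′e≡0) (settled-before e′≢b w′e′≡0)
                                    (trans (sym (val′-other e≢b)) (trans v≡v′ (val′-other e′≢b)))

    consistent : ∀ {x} → Consistent w′ val′ x → Consistent w val x × x a < x b
    consistent {x} C′ = C , candidate-<high C′ a b 0<w′a (merge-loser w a≢b) (candidate-high V 0<wb)
      where
      xb : x b ≡ k + n + h
      xb = trans (settled C′ b (merge-loser w a≢b)) val′-loser
      agrees : ∀ e → w e ≡ 0 → x e ≡ val e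
      agrees e we≡0 = let w′e≡0 , e≢b = settled-stays we≡0 in trans (settled C′ e w′e≡0) (val′-other e≢b)
      above : ∀ r → 0 < w r → k ≤ x r
      above r 0<wr with r ≟ᶠ b
      ... | yes refl = subst (k ≤_) (sym xb) k≤loser-value
      ... | no  r≢b  = candidate-≥k C′ r (candidate-stays 0<wr r≢b)
      below : ∀ r e → 0 < w r → w e ≡ 0 → k ≤ toℕ e → x r < x e
      below r e 0<wr we≡0 k≤e with r ≟ᶠ b
      ... | yes refl = subst₂ _<_ (sym xb) (sym (agrees e we≡0)) (high-settled V e k≤e we≡0)
      ... | no  r≢b  = candidate-<high C′ r e (candidate-stays 0<wr r≢b) (proj₁ (settled-stays we≡0)) k≤e
      C : Consistent w val x
      C = record { distinct = distinct C′ ; settled = agrees ; candidate-≥k = above ; candidate-<high = below }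

    charge : w b ≤ w a → ∀ o t f → (o ≡ a → 1 ≤ t) → W ≤ w′ o * 2 ^ f → W ≤ w o * 2 ^ (t + f)
    charge wb≤wa o t f o≡a⇒1≤t W≤ with o ≟ᶠ a | o ≟ᶠ b
    ... | yes refl | _        = ≤-trans W≤ (begin
      w′ a * 2 ^ f         ≡⟨ cong (_* 2 ^ f) (merge-winner w a≢b) ⟩
      (w a + w b) * 2 ^ f  ≤⟨ *-monoˡ-≤ (2 ^ f) (+-monoʳ-≤ (w a) wb≤wa) ⟩
      (w a + w a) * 2 ^ f  ≡⟨ double (w a) (2 ^ f) ⟩
      w a * 2 ^ (1 + f)    ≤⟨ *-monoʳ-≤ (w a) (^-monoʳ-≤ 2 (+-monoˡ-≤ f (o≡a⇒1≤t refl))) ⟩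
      w a * 2 ^ (t + f)    ∎)
      where
      open ≤-Reasoning
      double : ∀ u p → (u + u) * p ≡ u * (2 * p)
      double = solve-∀
    ... | no _     | yes refl = ≤-trans (≤-trans W≤ (≤-reflexive (cong (_* 2 ^ f) (merge-loser w a≢b)))) z≤n
    ... | no o≢a   | no o≢b   = 2^-weaken (w o) t f (subst (λ v → W ≤ v * 2 ^ f) (merge-other w o≢a o≢b) W≤)

  valid-left : ∀ {i j : Fin n} {l r w val} → Valid w val (height (cmp i j l r)) → Valid w val (height l)
  valid-left = weaken (≤-trans (m≤m⊔n _ _) (n≤1+n _))

  valid-right : ∀ {i j : Fin n} {l r w val} → Valid w val (height (cmp i j l r)) → Valid w val (height r)
  valid-right = weaken (≤-trans (m≤n⊔m _ _) (n≤1+n _))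

  Forces : Algorithm n → Set
  Forces T = ∀ w val → Valid w val (height T) → Correct T (Consistent w val) → Witness T w (Consistent w val)

  decided : ∀ {i j l r w val} → Decided i j (Consistent w val) → Valid w val (height (cmp i j l r)) →
            Forces l → Forces r → Correct (cmp i j l r) (Consistent w val) → Witness (cmp i j l r) w (Consistent w val)
  decided {i} {j} {l} {r} {w} {val} (inj₁ i<j) V forcesˡ _ correct =
    descend {w = w} {w′ = w} (λ s → s , next-< i j l r _ (i<j s)) (λ o f → 2^-weaken (w o) (involved o i j) f)
            correct (forcesˡ w val (valid-left {i} {j} {l} {r} V))
  decided {i} {j} {l} {r} {w} {val} (inj₂ i≮j) V _ forcesʳ correct =
    descend {w = w} {w′ = w} (λ s → s , next-≮ i j l r _ (i≮j s)) (λ o f → 2^-weaken (w o) (involved o i j) f)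
            correct (forcesʳ w val (valid-right {i} {j} {l} {r} V))

  compete : ∀ {i j l r w val} → Valid w val (height (cmp i j l r)) → i ≢ j → 0 < w i → 0 < w j →
            Forces l → Forces r → Correct (cmp i j l r) (Consistent w val) → Witness (cmp i j l r) w (Consistent w val)
  compete {i} {j} {l} {r} {w} {val} V i≢j 0<wi 0<wj forcesˡ forcesʳ correct with w j ≤? w i
  ... | yes wj≤wi = descend {w = w} {w′ = w′} into charge′ correct (forcesˡ w′ val′ valid)
    where
    open Elimination V i≢j 0<wi 0<wj (s≤s (m≤m⊔n (height l) (height r)))
    into : ∀ {x} → Consistent w′ val′ x → Consistent w val x × next i j l r x ≡ l
    into C′ = Prod.map₂ (next-< i j l r _) (consistent C′)
    charge′ : ∀ o f → W ≤ w′ o * 2 ^ f → W ≤ w o * 2 ^ (involved o i j + f)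
    charge′ o f = charge wj≤wi o (involved o i j) f
                    λ { refl → ≤-reflexive (sym (involved-left i j)) }
  ... | no  wj≰wi = descend {w = w} {w′ = w′} into charge′ correct (forcesʳ w′ val′ valid)
    where
    open Elimination V (i≢j ∘ sym) 0<wj 0<wi (s≤s (m≤n⊔m (height l) (height r)))
    into : ∀ {x} → Consistent w′ val′ x → Consistent w val x × next i j l r x ≡ r
    into C′ = Prod.map₂ (next-≮ i j l r _ ∘ <⇒≯) (consistent C′)
    charge′ : ∀ o f → W ≤ w′ o * 2 ^ f → W ≤ w o * 2 ^ (involved o i j + f)
    charge′ o f = charge (<⇒≤ (≰⇒> wj≰wi)) o (involved o i j) f
                    λ { refl → ≤-reflexive (sym (involved-right i j)) }

  -- The candidate c gets value k, just above the k low elements, and the other candidates go above c.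
  medianInput : Vector ℕ n → Vector ℕ n → Fin n → Input n
  medianInput w val c e with w e ≟ 0 | e ≟ᶠ c
  ... | yes _ | _     = val e
  ... | no _  | yes _ = k
  ... | no _  | no _  = suc (k + toℕ e)

  module MedianInput {w val h} (V : Valid w val h) {c} (0<wc : 0 < w c) where

    x : Input n
    x = medianInput w val c

    x-settled : ∀ e → w e ≡ 0 → x e ≡ val e
    x-settled e we≡0 with w e ≟ 0
    ... | yes _    = refl
    ... | no we≢0  = contradiction we≡0 we≢0

    x-median : x c ≡ k
    x-median with w c ≟ 0 | c ≟ᶠ c
    ... | yes wc≡0 | _       = contradiction wc≡0 (>⇒≢ 0<wc)
    ... | no _     | yes _   = refl
    ... | no _     | no c≢c  = contradiction refl c≢c

    x-other : ∀ e → 0 < w e → e ≢ c → x e ≡ suc (k + toℕ e)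
    x-other e 0<we e≢c with w e ≟ 0 | e ≟ᶠ c
    ... | yes we≡0 | _       = contradiction we≡0 (>⇒≢ 0<we)
    ... | no _     | yes e≡c = contradiction e≡c e≢c
    ... | no _     | no _    = refl

    x-candidate : ∀ e → 0 < w e → k ≤ x e × x e ≤ k + n
    x-candidate e 0<we = case e ≟ᶠ c of λ where
      (yes refl) → subst (λ v → k ≤ v × v ≤ k + n) (sym x-median) (≤-refl , m≤m+n k n)
      (no  e≢c)  → subst (λ v → k ≤ v × v ≤ k + n) (sym (x-other e 0<we e≢c))
                       ( ≤-trans (m≤m+n k (toℕ e)) (n≤1+n _)
                       , subst (_≤ k + n) (+-suc k (toℕ e)) (+-monoʳ-≤ k (toℕ<n e)))

    x-low : ∀ e → toℕ e < k → x e ≡ toℕ e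
    x-low e e<k = trans (x-settled e (proj₁ (low-settled V e e<k))) (proj₂ (low-settled V e e<k))

    x-high-settled : ∀ e → k ≤ toℕ e → w e ≡ 0 → k + n < x e
    x-high-settled e k≤e we≡0 =
      subst (k + n <_) (sym (x-settled e we≡0)) (≤-<-trans (m≤m+n (k + n) h) (high-settled V e k≤e we≡0))

    x-high : ∀ e → k ≤ toℕ e → k ≤ x e
    x-high e k≤e = case w e ≟ 0 of λ where
      (yes we≡0) → ≤-trans (m≤m+n k n) (<⇒≤ (x-high-settled e k≤e we≡0))
      (no  we≢0) → proj₁ (x-candidate e (n≢0⇒n>0 we≢0))

    x-high-other : ∀ e → k ≤ toℕ e → e ≢ c → k < x e
    x-high-other e k≤e e≢c = case w e ≟ 0 of λ where
      (yes we≡0) → ≤-<-trans (m≤m+n k n) (x-high-settled e k≤e we≡0)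
      (no  we≢0) → subst (k <_) (sym (x-other e (n≢0⇒n>0 we≢0) e≢c)) (s≤s (m≤m+n k (toℕ e)))

    settled≢candidate : ∀ e r → w e ≡ 0 → 0 < w r → x e ≢ x r
    settled≢candidate e r we≡0 0<wr xe≡xr with toℕ e <? k
    ... | yes e<k = <⇒≱ (subst (_< k) (sym (x-low e e<k)) e<k) (subst (k ≤_) (sym xe≡xr) (proj₁ (x-candidate r 0<wr)))
    ... | no  e≮k = <⇒≱ (x-high-settled e (≮⇒≥ e≮k) we≡0) (subst (_≤ k + n) (sym xe≡xr) (proj₂ (x-candidate r 0<wr)))

    candidates-distinct : ∀ e e′ → 0 < w e → 0 < w e′ → x e ≡ x e′ → e ≡ e′
    candidates-distinct e e′ 0<we 0<we′ xe≡xe′ = case ((e ≟ᶠ c) ,′ (e′ ≟ᶠ c)) of λ where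
      (yes refl , yes refl) → refl
      (yes refl , no e′≢c)  → contradiction (trans (sym x-median) xe≡xe′)
                                (<⇒≢ (x-high-other e′ (candidate-high V 0<we′) e′≢c))
      (no e≢c   , yes refl) → contradiction (trans (sym x-median) (sym xe≡xe′))
                                (<⇒≢ (x-high-other e (candidate-high V 0<we) e≢c))
      (no e≢c   , no e′≢c)  → toℕ-injective (+-cancelˡ-≡ k _ _ (suc-injective
                                  (trans (sym (x-other e 0<we e≢c)) (trans xe≡xe′ (x-other e′ 0<we′ e′≢c)))))

    x-distinct : DistinctInput x
    x-distinct {e} {e′} xe≡xe′ = case ((w e ≟ 0) ,′ (w e′ ≟ 0)) of λ where
      (yes we≡0 , yes we′≡0) → settled-unique V e e′ we≡0 we′≡0
                                 (trans (sym (x-settled e we≡0)) (trans xe≡xe′ (x-settled e′ we′≡0)))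
      (yes we≡0 , no we′≢0)  → contradiction xe≡xe′ (settled≢candidate e e′ we≡0 (n≢0⇒n>0 we′≢0))
      (no we≢0  , yes we′≡0) → contradiction (sym xe≡xe′) (settled≢candidate e′ e we′≡0 (n≢0⇒n>0 we≢0))
      (no we≢0  , no we′≢0)  → candidates-distinct e e′ (n≢0⇒n>0 we≢0) (n≢0⇒n>0 we′≢0) xe≡xe′

    consistent : Consistent w val x
    consistent = record
      { distinct        = x-distinct
      ; settled         = x-settled
      ; candidate-≥k    = λ r 0<wr → proj₁ (x-candidate r 0<wr)
      ; candidate-<high = λ r e 0<wr we≡0 k≤e → ≤-<-trans (proj₂ (x-candidate r 0<wr)) (x-high-settled e k≤e we≡0)
      }

    rank≡count : ∀ o → rank x o ≡ ∑[ e < n ] 𝟙 (x e <? x o)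
    rank≡count o = length-filter-tabulate (λ e → x e <? x o) id

    low-rank : ∀ o → toℕ o < k → rank x o < k
    low-rank o o<k = begin-strict
      rank x o                         ≡⟨ rank≡count o ⟩
      ∑[ e < n ] 𝟙 (x e <? x o)         ≤⟨ sum-mono-≤ (λ e → 𝟙-mono (below e) (x e <? x o) (toℕ e <? toℕ o)) ⟩
      ∑[ e < n ] 𝟙 (toℕ e <? toℕ o)     ≡⟨ count-toℕ< (toℕ o) (<⇒≤ (toℕ<n o)) ⟩
      toℕ o                            <⟨ o<k ⟩
      k                                ∎
      where
      open ≤-Reasoning
      xo≡o : x o ≡ toℕ o
      xo≡o = x-low o o<k
      below : ∀ e → x e < x o → toℕ e < toℕ o
      below e xe<xo = case toℕ e <? k of λ where
        (yes e<k) → subst₂ _<_ (x-low e e<k) xo≡o xe<xo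
        (no  e≮k) → contradiction (x-high e (≮⇒≥ e≮k)) (<⇒≱ (<-trans (subst (x e <_) xo≡o xe<xo) o<k))

    high-rank : ∀ o → k ≤ toℕ o → o ≢ c → k < rank x o
    high-rank o k≤o o≢c = begin-strict
      k                                ≡⟨ count-toℕ< k k≤n ⟨
      ∑[ e < n ] 𝟙 (toℕ e <? k)         <⟨ sum-mono-< (λ e → 𝟙-mono (below e) (toℕ e <? k) (x e <? x o)) c
                                            (𝟙-< (≤⇒≯ (candidate-high V 0<wc)) c-below (toℕ c <? k) (x c <? x o)) ⟩
      ∑[ e < n ] 𝟙 (x e <? x o)         ≡⟨ rank≡count o ⟨
      rank x o                         ∎
      where
      open ≤-Reasoning
      k<xo : k < x o
      k<xo = x-high-other o k≤o o≢c
      below : ∀ e → toℕ e < k → x e < x o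
      below e e<k = subst (_< x o) (sym (x-low e e<k)) (<-trans e<k k<xo)
      c-below : x c < x o
      c-below = subst (_< x o) (sym x-median) k<xo

    median-unique : ∀ o → IsMedian x o → o ≡ c
    median-unique o rank≡k = case o ≟ᶠ c of λ where
      (yes o≡c) → o≡c
      (no  o≢c) → case toℕ o <? k of λ where
        (yes o<k) → contradiction rank≡k (<⇒≢ (low-rank o o<k))
        (no  o≮k) → contradiction rank≡k (>⇒≢ (high-rank o (≮⇒≥ o≮k) o≢c))

  leaf-forced : ∀ o → Forces (leaf o)
  leaf-forced o w val V correct = case w o ≟ W of λ where
    (yes wo≡W) → let open MedianInput V (subst (0 <_) (sym wo≡W) (m<n⇒0<n∸m (k<n o))) in
                 x , consistent , ≤-reflexive (sym (trans (*-identityʳ (w o)) wo≡W))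
    (no  wo≢W) → let (c , c≢o , 0<wc) = sum-positive-elsewhere w o (λ wo≡Σ → wo≢W (trans wo≡Σ (total-weight V)))
                     open MedianInput V 0<wc
                 in contradiction (sym (median-unique o (correct x consistent))) c≢o

  adversary : ∀ T → Forces T
  adversary (leaf o) = leaf-forced o
  adversary (cmp i j l r) w val V correct with i ≟ᶠ j | w i ≟ 0 | w j ≟ 0
  ... | yes refl | _        | _        = decided (inj₂ λ _ → <-irrefl refl) V (adversary l) (adversary r) correct
  ... | no _     | yes wi≡0 | yes wj≡0 = decided (settled-decided wi≡0 wj≡0) V (adversary l) (adversary r) correct
  ... | no _     | yes wi≡0 | no wj≢0  =
    decided (separated⇒decided (settled-vs-candidate V wi≡0 (n≢0⇒n>0 wj≢0))) V (adversary l) (adversary r) correct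
  ... | no _     | no wi≢0  | yes wj≡0 =
    decided (separated⇒decided (Sum.swap (settled-vs-candidate V wj≡0 (n≢0⇒n>0 wi≢0))))
            V (adversary l) (adversary r) correct
  ... | no i≢j   | no wi≢0  | no wj≢0  =
    compete V i≢j (n≢0⇒n>0 wi≢0) (n≢0⇒n>0 wj≢0) (adversary l) (adversary r) correct

  initial-weight : Vector ℕ n
  initial-weight e = 𝟙 (k ≤? toℕ e)

  initial-valid : ∀ h → Valid initial-weight toℕ h
  initial-valid h = record
    { low-settled    = λ e e<k → 𝟙-no (<⇒≱ e<k) (k ≤? toℕ e) , refl
    ; high-settled   = λ e k≤e w≡0 → contradiction (trans (sym (𝟙-yes k≤e (k ≤? toℕ e))) w≡0) λ ()
    ; settled-unique = λ _ _ _ _ → toℕ-injective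
    ; total-weight   = trans (sym (m+n∸n≡m _ k)) (cong (_∸ k) weight+k)
    }
    where
    open ≡-Reasoning
    split : ∀ e → initial-weight e + 𝟙 (toℕ e <? k) ≡ 𝟙 (toℕ e <? n)
    split e = trans (case toℕ e <? k of λ where
        (yes e<k) → cong₂ _+_ (𝟙-no (<⇒≱ e<k) (k ≤? toℕ e)) (𝟙-yes e<k (toℕ e <? k))
        (no  e≮k) → cong₂ _+_ (𝟙-yes (≮⇒≥ e≮k) (k ≤? toℕ e)) (𝟙-no e≮k (toℕ e <? k)))
      (sym (𝟙-yes (toℕ<n e) (toℕ e <? n)))
    weight+k : sum initial-weight + k ≡ n
    weight+k = begin
      sum initial-weight + k                               ≡⟨ cong (sum initial-weight +_) (count-toℕ< k k≤n) ⟨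
      sum initial-weight + ∑[ e < n ] 𝟙 (toℕ e <? k)       ≡⟨ ∑-distrib-+ initial-weight (λ e → 𝟙 (toℕ e <? k)) ⟨
      ∑[ e < n ] (initial-weight e + 𝟙 (toℕ e <? k))       ≡⟨ sum-cong-≗ split ⟩
      ∑[ e < n ] 𝟙 (toℕ e <? n)                            ≡⟨ count-toℕ< n ≤-refl ⟩
      n                                                    ∎

  log-bound : ∀ o f → W ≤ initial-weight o * 2 ^ f → ⌈log₂ n ⌉ ∸ 1 ≤ f
  log-bound o f W≤ = ⌈log₂⌉∸1≤ f (≤-trans n≤2W (*-monoʳ-≤ 2 W≤2^f))
    where
    W≤2^f : W ≤ 2 ^ f
    W≤2^f = ≤-trans W≤ (≤-trans (*-monoˡ-≤ (2 ^ f) (𝟙≤1 (k ≤? toℕ o))) (≤-reflexive (*-identityˡ (2 ^ f))))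

corollary3 : (n : ℕ) → (A : Algorithm n) → FindsMedian A →
    Σ (Input n) (λ x → DistinctInput x × (fragility A x (run A x) ≥ ⌈log₂ n ⌉ ∸ 1))
corollary3 n A findsMedian = conclude (adversary A initial-weight toℕ (initial-valid (height A)) correct)
  where
  open Adversary n
  correct : Correct A (Consistent initial-weight toℕ)
  correct x C = findsMedian x (Consistent.distinct C)
  conclude : Witness A initial-weight (Consistent initial-weight toℕ) →
             Σ (Input n) (λ x → DistinctInput x × (fragility A x (run A x) ≥ ⌈log₂ n ⌉ ∸ 1))
  conclude (x , C , W≤) = x , Consistent.distinct C , log-bound (run A x) _ W≤
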